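{- Let $G$ be a graph of order $n$ and let $D_n$ be a maximal Diophantine graph of order $n$. If $\alpha(G)\ge n-F(D_n)$, then $G$ is a Diophantine graph.
   Context: All graphs are finite, simple and undirected. A graph $G$ with $n$ vertices is Diophantine if there is a bijection $f:V(G)\to\{1,\dots,n\}$ such that $\gcd(f(u),f(v))\mid n$ for every edge $uv$. A maximal Diophantine graph $D_n$ of order $n$ is a Diophantine graph of order $n$ such that adding any new edge yields a non-Diophantine graph. $\alpha(G)$ is the independence number of $G$ and $F(H)$ is the number of vertices of a graph $H$ of degree $|V(H)|-1$. -}

module Defs where

open import Data.Nat using (ℕ; suc; _∸_; _≤_)
open import Data.Nat.GCD using (gcd)
open import Data.Nat.Divisibility using (_∣_)
open import Data.Bool using (Bool; true; false; T)
open import Data.Fin using (Fin; toℕ)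
open import Data.Fin.Subset using (Subset; _∈_; ∣_∣)
open import Data.Fin.Properties using (any?)
open import Data.Vec using (count)
open import Data.Vec.Functional using ()
open import Data.Vec using (tabulate)
open import Data.Product using (Σ; _×_; ∃)
open import Data.Sum using (_⊎_)
open import Function.Bundles using (_⇔_)
open import Function.Bundles using (_⤖_; Bijection)
open import Relation.Binary.PropositionalEquality using (_≡_)
open import Relation.Nullary using (¬_)
open import Data.Nat using (_≟_)

record Graph (n : ℕ) : Set where
  field
    adj   : Fin n → Fin n → Bool
    sym   : ∀ u v → adj u v ≡ adj v u
    irref : ∀ v → adj v v ≡ false
open Graph public

Edge : ∀ {n} → Graph n → Fin n → Fin n → Set
Edge G u v = T (adj G u v)

label : ∀ {n} → (Fin n ⤖ Fin n) → Fin n → ℕ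
label f v = suc (toℕ (Bijection.to f v))

DiophantineLabeling : ∀ {n} → Graph n → (Fin n ⤖ Fin n) → Set
DiophantineLabeling {n} G f =
  ∀ u v → Edge G u v → gcd (label f u) (label f v) ∣ n

Diophantine : ∀ {n} → Graph n → Set
Diophantine {n} G = Σ (Fin n ⤖ Fin n) (DiophantineLabeling G)

AddsOneEdge : ∀ {n} → Graph n → Graph n → Set
AddsOneEdge {n} G H = ∃ λ u → ∃ λ v → ¬ (u ≡ v) × ¬ Edge G u v ×
  (∀ x y → Edge H x y ⇔ (Edge G x y ⊎ ((x ≡ u × y ≡ v) ⊎ (x ≡ v × y ≡ u))))

MaximalDiophantine : ∀ {n} → Graph n → Set
MaximalDiophantine {n} D =
  Diophantine D × (∀ (H : Graph n) → AddsOneEdge D H → ¬ Diophantine H)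

degree : ∀ {n} → Graph n → Fin n → ℕ
degree {n} G v = count (λ w → T? (adj G v w)) (tabulate (λ w → w))
  where
    open import Relation.Nullary.Decidable using (Dec)
    open import Data.Bool using (T?)

F : ∀ {n} → Graph n → ℕ
F {n} H = count (λ v → degree H v ≟ (n ∸ 1)) (tabulate (λ v → v))

Independent : ∀ {n} → Graph n → Subset n → Set
Independent G S = ∀ u v → u ∈ S → v ∈ S → ¬ Edge G u v

-- α(G) ≥ k  (α(G) is the maximum size of an independent set)
αAtLeast : ∀ {n} → Graph n → ℕ → Set
αAtLeast {n} G k = Σ (Subset n) λ S → Independent G S × k ≤ ∣ S ∣

{-# OPTIONS --safe #-}
module Submission where

-- A vertex of D of degree n − 1 is adjacent to every other vertex. The complement of an
-- independent set of G with at least n − F(D) vertices meets every edge of G and has at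
-- most F(D) vertices, so some permutation of the vertices carries it into the full-degree
-- vertices of D. That permutation maps every edge of G to an edge of D, so composing it
-- with a Diophantine labelling of D labels G.

open import Defs hiding (sym)
open import Data.Nat using (ℕ; suc; _∸_; _≟_; _≤_; _<_; z≤n; s≤s)
open import Data.Nat.Properties using (module ≤-Reasoning; ≡ᵇ⇒≡; <⇒≢; ≤-reflexive; <-≤-trans; m≤n⇒m≤1+n; <⇒≱; ∸-monoʳ-≤; m∸[m∸n]≡n)
open import Data.Fin using (Fin; toℕ; fromℕ<; punchIn) renaming (zero to 0F; suc to 1+)
open import Data.Fin.Properties using (toℕ-fromℕ<)
open import Data.Fin.Permutation using (Permutation′; _⟨$⟩ʳ_; insert; id; flip; _∘ₚ_; inverseʳ)
open import Data.Fin.Subset using (Subset; _∈_; _∉_; _⊆_; ∣_∣; ∁; ⁅_⁆; inside; outside)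
open import Data.Fin.Subset.Properties using (_∈?_; drop-not-there; ∣p∣≤n; p⊂q⇒∣p∣<∣q∣; ∣∁p∣≡n∸∣p∣; ∣⁅x⁆∣≡1; x∉p⇒x∈∁p; x≢y⇒x∉⁅y⁆)
open import Data.Vec using ([]; _∷_; here; there; tabulate; count)
open import Data.Vec.Properties using (lookup∘tabulate; []=⇒lookup)
open import Data.Bool using (Bool; true; false; T; T?)
open import Data.Bool.Properties using (T-≡)
open import Data.Product using (Σ; _,_; proj₁; proj₂)
open import Data.Sum using (_⊎_; inj₁; inj₂)
open import Function using (_∘_)
open import Function.Bundles using (_⤖_; Bijection; Equivalence)
open import Function.Construct.Composition using (_⤖-∘_)
open import Function.Properties.Inverse using (↔⇒⤖)
open import Relation.Binary.PropositionalEquality using (_≡_; _≢_; refl; sym; trans; cong; subst)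
open import Relation.Nullary using (yes; no; does; contradiction)
open import Relation.Unary using (Pred; Decidable)

toℕ-punchIn-< : ∀ {n} (i : Fin (suc n)) (j : Fin n) → toℕ j < toℕ i → toℕ (punchIn i j) ≡ toℕ j
toℕ-punchIn-< (1+ i) 0F      _       = refl
toℕ-punchIn-< (1+ i) (1+ j) (s≤s j<i) = cong suc (toℕ-punchIn-< i j j<i)

toℕ-punchIn-≥ : ∀ {n} (i : Fin (suc n)) (j : Fin n) → toℕ i ≤ toℕ j → toℕ (punchIn i j) ≡ suc (toℕ j)
toℕ-punchIn-≥ 0F     j      _         = refl
toℕ-punchIn-≥ (1+ i) (1+ j) (s≤s i≤j) = cong suc (toℕ-punchIn-≥ i j i≤j)

-- rank p numbers the elements of p by 0, …, ∣ p ∣ − 1 and the other vertices by ∣ p ∣, …, n − 1.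
rank : ∀ {n} → Subset n → Permutation′ n
rank []            = id
rank (inside  ∷ p) = insert 0F 0F (rank p)
rank (outside ∷ p) = insert 0F (fromℕ< (s≤s (∣p∣≤n p))) (rank p)

rank-∈ : ∀ {n} (p : Subset n) {v} → v ∈ p → toℕ (rank p ⟨$⟩ʳ v) < ∣ p ∣
rank-∈ (inside  ∷ p) here        = s≤s z≤n
rank-∈ (inside  ∷ p) (there v∈p) = s≤s (rank-∈ p v∈p)
rank-∈ {suc n} (outside ∷ p) {1+ v} (there v∈p) = begin-strict
  toℕ (punchIn k (rank p ⟨$⟩ʳ v)) ≡⟨ toℕ-punchIn-< k _ below-k ⟩
  toℕ (rank p ⟨$⟩ʳ v)             <⟨ IH ⟩
  ∣ p ∣                           ∎
  where
  open ≤-Reasoning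
  k : Fin (suc n)
  k = fromℕ< (s≤s (∣p∣≤n p))
  IH : toℕ (rank p ⟨$⟩ʳ v) < ∣ p ∣
  IH = rank-∈ p v∈p
  below-k : toℕ (rank p ⟨$⟩ʳ v) < toℕ k
  below-k = subst (toℕ (rank p ⟨$⟩ʳ v) <_) (sym (toℕ-fromℕ< _)) IH

rank-∉ : ∀ {n} (p : Subset n) {v} → v ∉ p → ∣ p ∣ ≤ toℕ (rank p ⟨$⟩ʳ v)
rank-∉ (inside  ∷ p) {0F}   v∉p = contradiction here v∉p
rank-∉ (outside ∷ p) {0F}   v∉p = ≤-reflexive (sym (toℕ-fromℕ< _))
rank-∉ (inside  ∷ p) {1+ v} v∉p = s≤s (rank-∉ p (drop-not-there v∉p))
rank-∉ {suc n} (outside ∷ p) {1+ v} v∉p = begin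
  ∣ p ∣                               ≤⟨ m≤n⇒m≤1+n IH ⟩
  suc (toℕ (rank p ⟨$⟩ʳ v))           ≡⟨ sym (toℕ-punchIn-≥ k _ above-k) ⟩
  toℕ (punchIn k (rank p ⟨$⟩ʳ v))     ∎
  where
  open ≤-Reasoning
  k : Fin (suc n)
  k = fromℕ< (s≤s (∣p∣≤n p))
  IH : ∣ p ∣ ≤ toℕ (rank p ⟨$⟩ʳ v)
  IH = rank-∉ p (drop-not-there v∉p)
  above-k : toℕ k ≤ toℕ (rank p ⟨$⟩ʳ v)
  above-k = subst (_≤ toℕ (rank p ⟨$⟩ʳ v)) (sym (toℕ-fromℕ< _)) IH

∣p∣≤∣q∣⇒permutation-into : ∀ {n} (p q : Subset n) → ∣ p ∣ ≤ ∣ q ∣ →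
  Σ (Permutation′ n) λ π → ∀ {v} → v ∈ p → π ⟨$⟩ʳ v ∈ q
∣p∣≤∣q∣⇒permutation-into {n} p q ∣p∣≤∣q∣ = π , π-into
  where
  π : Permutation′ n
  π = rank p ∘ₚ flip (rank q)
  π-into : ∀ {v} → v ∈ p → π ⟨$⟩ʳ v ∈ q
  π-into {v} v∈p with π ⟨$⟩ʳ v ∈? q
  ... | yes πv∈q = πv∈q
  ... | no  πv∉q = contradiction (rank-∉ q πv∉q) (<⇒≱ ranked-within-q)
    where
    ranked-within-q : toℕ (rank q ⟨$⟩ʳ (π ⟨$⟩ʳ v)) < ∣ q ∣
    ranked-within-q = subst (λ i → toℕ i < ∣ q ∣) (sym (inverseʳ (rank q)))
                        (<-≤-trans (rank-∈ p v∈p) ∣p∣≤∣q∣)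

count-tabulate : ∀ {a p} {A : Set a} {P : Pred A p} (P? : Decidable P) {n} (f : Fin n → A) →
  count P? (tabulate f) ≡ ∣ tabulate (λ i → does (P? (f i))) ∣
count-tabulate P? {0}     f = refl
count-tabulate P? {suc n} f with does (P? (f 0F))
... | true  = cong suc (count-tabulate P? (f ∘ 1+))
... | false = count-tabulate P? (f ∘ 1+)

∈-tabulate⁻ : ∀ {n} {f : Fin n → Bool} {v} → v ∈ tabulate f → T (f v)
∈-tabulate⁻ {f = f} {v} v∈ =
  Equivalence.from T-≡ (trans (sym (lookup∘tabulate f v)) ([]=⇒lookup v∈))

∉-∉⇒∣p∣<n∸1 : ∀ {n} {p : Subset n} {v w} → v ∉ p → w ∉ p → w ≢ v → ∣ p ∣ < n ∸ 1
∉-∉⇒∣p∣<n∸1 {n} {p} {v} {w} v∉p w∉p w≢v = begin-strict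
  ∣ p ∣           <⟨ p⊂q⇒∣p∣<∣q∣ (p⊆∁⁅v⁆ , w , x∉p⇒x∈∁p (x≢y⇒x∉⁅y⁆ w≢v) , w∉p) ⟩
  ∣ ∁ ⁅ v ⁆ ∣     ≡⟨ ∣∁p∣≡n∸∣p∣ ⁅ v ⁆ ⟩
  n ∸ ∣ ⁅ v ⁆ ∣   ≡⟨ cong (n ∸_) (∣⁅x⁆∣≡1 v) ⟩
  n ∸ 1           ∎
  where
  open ≤-Reasoning
  p⊆∁⁅v⁆ : p ⊆ ∁ ⁅ v ⁆
  p⊆∁⁅v⁆ {x} x∈p = x∉p⇒x∈∁p (x≢y⇒x∉⁅y⁆ λ { refl → v∉p x∈p })

module _ {n} (G : Graph n) where

  neighbours : Fin n → Subset n
  neighbours v = tabulate (adj G v)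

  fullVertices : Subset n
  fullVertices = tabulate (λ v → does (degree G v ≟ n ∸ 1))

  degree≡∣neighbours∣ : ∀ v → degree G v ≡ ∣ neighbours v ∣
  degree≡∣neighbours∣ v = count-tabulate (T? ∘ adj G v) (λ w → w)

  F≡∣fullVertices∣ : F G ≡ ∣ fullVertices ∣
  F≡∣fullVertices∣ = count-tabulate (λ v → degree G v ≟ n ∸ 1) (λ v → v)

  Edge-sym : ∀ {u v} → Edge G u v → Edge G v u
  Edge-sym {u} {v} = subst T (Graph.sym G u v)

  Edge⇒≢ : ∀ {u v} → Edge G u v → u ≢ v
  Edge⇒≢ {u} loop refl = subst T (irref G u) loop

  full⇒adjacent : ∀ {v w} → v ∈ fullVertices → w ≢ v → Edge G v w
  full⇒adjacent {v} {w} v-full w≢v with w ∈? neighbours v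
  ... | yes w∈N = ∈-tabulate⁻ w∈N
  ... | no  w∉N = contradiction ∣N∣≡n∸1 (<⇒≢ (∉-∉⇒∣p∣<n∸1 v∉N w∉N w≢v))
    where
    v∉N : v ∉ neighbours v
    v∉N v∈N = Edge⇒≢ (∈-tabulate⁻ v∈N) refl
    -- does (m ≟ n) computes to m ≡ᵇ n.
    ∣N∣≡n∸1 : ∣ neighbours v ∣ ≡ n ∸ 1
    ∣N∣≡n∸1 = trans (sym (degree≡∣neighbours∣ v)) (≡ᵇ⇒≡ (degree G v) (n ∸ 1) (∈-tabulate⁻ v-full))

  VertexCover : Subset n → Set
  VertexCover C = ∀ {u v} → Edge G u v → u ∈ C ⊎ v ∈ C

  Independent⇒∁-VertexCover : ∀ {S} → Independent G S → VertexCover (∁ S)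
  Independent⇒∁-VertexCover {S} S-indep {u} {v} uv with u ∈? S | v ∈? S
  ... | no  u∉S | _       = inj₁ (x∉p⇒x∈∁p u∉S)
  ... | yes _   | no  v∉S = inj₂ (x∉p⇒x∈∁p v∉S)
  ... | yes u∈S | yes v∈S = contradiction uv (S-indep u v u∈S v∈S)

Diophantine-pullback : ∀ {n} {G D : Graph n} (π : Fin n ⤖ Fin n) →
  (∀ {u v} → Edge G u v → Edge D (Bijection.to π u) (Bijection.to π v)) →
  Diophantine D → Diophantine G
Diophantine-pullback π preserves (f , f-labels) =
  f ⤖-∘ π , λ u v uv → f-labels _ _ (preserves uv)

VertexCover⇒Diophantine : ∀ {n} (G D : Graph n) {C} → VertexCover G C →
  ∣ C ∣ ≤ ∣ fullVertices D ∣ → Diophantine D → Diophantine G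
VertexCover⇒Diophantine {n} G D {C} C-covers ∣C∣≤∣full∣ =
  Diophantine-pullback {G = G} {D = D} π G⇒D
  where
  σ : Σ (Permutation′ n) λ ρ → ∀ {v} → v ∈ C → ρ ⟨$⟩ʳ v ∈ fullVertices D
  σ = ∣p∣≤∣q∣⇒permutation-into C (fullVertices D) ∣C∣≤∣full∣
  π : Fin n ⤖ Fin n
  π = ↔⇒⤖ (proj₁ σ)
  open Bijection π using (to; injective)

  G⇒D : ∀ {u v} → Edge G u v → Edge D (to u) (to v)
  G⇒D uv with C-covers uv
  ... | inj₁ u∈C = full⇒adjacent D (proj₂ σ u∈C) (Edge⇒≢ G (Edge-sym G uv) ∘ injective)
  ... | inj₂ v∈C = Edge-sym D (full⇒adjacent D (proj₂ σ v∈C) (Edge⇒≢ G uv ∘ injective))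

theorem3p10 : (n : ℕ) (G D : Graph n) → MaximalDiophantine D →
    αAtLeast G (n ∸ F D) → Diophantine G
theorem3p10 n G D (D-dioph , _) (S , S-indep , n∸FD≤∣S∣) =
  VertexCover⇒Diophantine G D (Independent⇒∁-VertexCover G S-indep) ∣∁S∣≤∣full∣ D-dioph
  where
  open ≤-Reasoning
  ∣∁S∣≤∣full∣ : ∣ ∁ S ∣ ≤ ∣ fullVertices D ∣
  ∣∁S∣≤∣full∣ = begin
    ∣ ∁ S ∣            ≡⟨ ∣∁p∣≡n∸∣p∣ S ⟩
    n ∸ ∣ S ∣          ≤⟨ ∸-monoʳ-≤ n n∸FD≤∣S∣ ⟩
    n ∸ (n ∸ F D)      ≡⟨ m∸[m∸n]≡n (subst (_≤ n) (sym (F≡∣fullVertices∣ D)) (∣p∣≤n (fullVertices D))) ⟩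
    F D                ≡⟨ F≡∣fullVertices∣ D ⟩
    ∣ fullVertices D ∣ ∎
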